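{- Let $n\ge 3$ and $m\ge 2$. Then player B wins the general position avoidance game on the grid $P_n\,\square\,P_m$, where $P_k$ denotes the path on $k$ vertices.
   Context: The Cartesian product $G\,\square\,H$ has vertex set $V(G)\times V(H)$, with $(g_1,h_1)$ adjacent to $(g_2,h_2)$ iff either $g_1=g_2$ and $h_1h_2\in E(H)$, or $h_1=h_2$ and $g_1g_2\in E(G)$. A set $S$ of vertices of a graph is a general position set if no three distinct vertices of $S$ lie on a common shortest path. In the general position avoidance game on a graph, players A and B alternately select vertices, with A moving first; a selection is legal if the vertex was not selected before and the set of all selected vertices is a general position set. The game ends when no legal move remains, and the player who selects the last vertex loses. "Player X wins" means X has a winning strategy. -}

module Defs where

open import Level using (Level; suc; _⊔_)
open import Data.Nat using (ℕ; _+_; _≤_)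
import Data.Nat as ℕ
open import Data.Fin using (Fin; toℕ)
open import Data.Product using (_×_; _,_; Σ; ∃)
open import Data.Sum using (_⊎_)
open import Data.List using (List; []; _∷_)
open import Data.List.Membership.Propositional using (_∈_; _∉_)
open import Relation.Binary.PropositionalEquality using (_≡_; _≢_)
open import Relation.Nullary using (¬_)

record Graph : Set₁ where
  field
    V : Set
    E : V → V → Set
open Graph public

P : ℕ → Graph
P k = record { V = Fin k ; E = λ i j → (toℕ i + 1 ≡ toℕ j) ⊎ (toℕ j + 1 ≡ toℕ i) }

_□_ : Graph → Graph → Graph
G □ H = record
  { V = V G × V H
  ; E = λ { (g₁ , h₁) (g₂ , h₂) → (g₁ ≡ g₂ × E H h₁ h₂) ⊎ (h₁ ≡ h₂ × E G g₁ g₂) } }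

data Walk (G : Graph) : V G → V G → Set where
  [_]  : (u : V G) → Walk G u u
  _∷⟨_⟩_ : (u : V G) {v w : V G} → E G u v → Walk G v w → Walk G u w

length : {G : Graph} {u w : V G} → Walk G u w → ℕ
length [ u ] = 0
length (u ∷⟨ e ⟩ p) = ℕ.suc (length p)

data _OnWalk_ {G : Graph} (x : V G) : {u w : V G} → Walk G u w → Set where
  here-end : x OnWalk [ x ]
  here     : {v w : V G} (e : E G x v) (p : Walk G v w) → x OnWalk (x ∷⟨ e ⟩ p)
  there    : {u v w : V G} (e : E G u v) (p : Walk G v w) → x OnWalk p → x OnWalk (u ∷⟨ e ⟩ p)

Shortest : {G : Graph} {u w : V G} → Walk G u w → Set
Shortest {G} {u} {w} p = (q : Walk G u w) → length p ≤ length q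

GeneralPosition : (G : Graph) → List (V G) → Set
GeneralPosition G S =
  (u w : V G) (p : Walk G u w) → Shortest p →
  (a b c : V G) → a ∈ S → b ∈ S → c ∈ S → a ≢ b → b ≢ c → a ≢ c →
  ¬ (a OnWalk p × b OnWalk p × c OnWalk p)

Legal : (G : Graph) → List (V G) → V G → Set
Legal G S v = v ∉ S × GeneralPosition G (v ∷ S)

NoMove : (G : Graph) → List (V G) → Set
NoMove G S = (v : V G) → ¬ Legal G S v

-- Avoidance (misère) game: the player who selects the last vertex loses.
-- Position = list of selected vertices.
-- If no legal move remains, the previous player selected the last vertex, so
-- the player to move wins.
data MoverWins (G : Graph) (S : List (V G)) : Set
data MoverLoses (G : Graph) (S : List (V G)) : Set

data MoverWins G S where
  gameOver : NoMove G S → MoverWins G S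
  move     : (v : V G) → Legal G S v → MoverLoses G (v ∷ S) → MoverWins G S

data MoverLoses G S where
  allLose : (Σ (V G) λ v → Legal G S v) →
            ((v : V G) → Legal G S v → MoverWins G (v ∷ S)) → MoverLoses G S

-- Player A moves first from the empty position; B wins iff A (the mover) loses.
BWins : Graph → Set
BWins G = MoverLoses G []

AWins : Graph → Set
AWins G = MoverWins G []

module Submission where

-- Distances in P n □ P m are Manhattan distances, so three vertices lie on a common shortest path
-- iff one of them lies between the other two in both coordinates.  Seen from a corner k, two
-- further vertices either line up with k or cross (their orders from k in the two coordinates
-- disagree), and crossings chain; hence among k and any three further vertices some triple lines
-- up, so a general position set containing a corner has at most three vertices.  B answers A's
-- first move a with a vertex b such that a or b is a corner and some third vertex still keeps the
-- set in general position: A must then select a third vertex, which is the last one.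

open import Defs
open import Data.Nat using (ℕ; zero; suc; _+_; _≤_; _<_; z≤n; s≤s; s≤s⁻¹; ∣_-_∣; _∸_; _≟_)
open import Data.Nat.Properties
open import Algebra.Properties.CommutativeSemigroup +-commutativeSemigroup using (interchange)
open import Data.Fin using (Fin; toℕ; fromℕ; fromℕ<)
import Data.Fin as Fin
open import Data.Fin.Properties using (toℕ-injective; toℕ<n; toℕ-fromℕ<; toℕ-fromℕ)
open import Data.Product using (_×_; _,_; Σ; proj₁; proj₂)
open import Data.Sum using (_⊎_; inj₁; inj₂; [_,_]′; swap)
open import Data.List using (List; []; _∷_)
open import Data.List.Relation.Unary.Any using (here; there)
open import Data.List.Membership.Propositional using (_∈_; _∉_)
open import Data.Empty using (⊥)
open import Function using (_∘_)
open import Relation.Binary.PropositionalEquality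
open import Relation.Nullary using (¬_; yes; no; contradiction)

module _ {G : Graph} where

  infixr 5 _++ᵂ_

  _++ᵂ_ : ∀ {u v w} → Walk G u v → Walk G v w → Walk G u w
  [ u ] ++ᵂ q = q
  (u ∷⟨ e ⟩ p) ++ᵂ q = u ∷⟨ e ⟩ (p ++ᵂ q)

  length-++ᵂ : ∀ {u v w} (p : Walk G u v) (q : Walk G v w) → length (p ++ᵂ q) ≡ length p + length q
  length-++ᵂ [ u ] q = refl
  length-++ᵂ (u ∷⟨ e ⟩ p) q = cong suc (length-++ᵂ p q)

  start-on : ∀ {u w} (p : Walk G u w) → u OnWalk p
  start-on [ u ] = here-end
  start-on (u ∷⟨ e ⟩ p) = here e p

  end-on : ∀ {u w} (p : Walk G u w) → w OnWalk p
  end-on [ u ] = here-end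
  end-on (u ∷⟨ e ⟩ p) = there e p (end-on p)

  on-++ᵂʳ : ∀ {u v w x} (p : Walk G u v) {q : Walk G v w} → x OnWalk q → x OnWalk (p ++ᵂ q)
  on-++ᵂʳ [ u ] o = o
  on-++ᵂʳ (u ∷⟨ e ⟩ p) o = there e _ (on-++ᵂʳ p o)

  module _ (E-sym : ∀ {u v} → E G u v → E G v u) where

    reverseᵂ : ∀ {u w} → Walk G u w → Walk G w u
    reverseᵂ [ u ] = [ u ]
    reverseᵂ (u ∷⟨ e ⟩ p) = reverseᵂ p ++ᵂ (_ ∷⟨ E-sym e ⟩ [ u ])

    length-reverseᵂ : ∀ {u w} (p : Walk G u w) → length (reverseᵂ p) ≡ length p
    length-reverseᵂ [ u ] = refl
    length-reverseᵂ (u ∷⟨ e ⟩ p) = begin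
      length (reverseᵂ p ++ᵂ (_ ∷⟨ E-sym e ⟩ [ u ])) ≡⟨ length-++ᵂ (reverseᵂ p) _ ⟩
      length (reverseᵂ p) + 1                         ≡⟨ cong (_+ 1) (length-reverseᵂ p) ⟩
      length p + 1                                    ≡⟨ +-comm (length p) 1 ⟩
      suc (length p)                                  ∎
      where open ≡-Reasoning

module _ {G H : Graph} (f : V G → V H) (f-edge : ∀ {u v} → E G u v → E H (f u) (f v)) where

  mapᵂ : ∀ {u w} → Walk G u w → Walk H (f u) (f w)
  mapᵂ [ u ] = [ f u ]
  mapᵂ (u ∷⟨ e ⟩ p) = f u ∷⟨ f-edge e ⟩ mapᵂ p

  length-mapᵂ : ∀ {u w} (p : Walk G u w) → length (mapᵂ p) ≡ length p
  length-mapᵂ [ u ] = refl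
  length-mapᵂ (u ∷⟨ e ⟩ p) = cong suc (length-mapᵂ p)

-- Betweenness of natural numbers

Between : ℕ → ℕ → ℕ → Set
Between i j k = (i ≤ j × j ≤ k) ⊎ (k ≤ j × j ≤ i)

Between-sym : ∀ {i j k} → Between i j k → Between k j i
Between-sym = swap

Between-total : ∀ i j k → Between i j k ⊎ Between j i k ⊎ Between i k j
Between-total i j k with ≤-total i j | ≤-total j k | ≤-total i k
... | inj₁ i≤j | inj₁ j≤k | _       = inj₁ (inj₁ (i≤j , j≤k))
... | inj₁ i≤j | inj₂ k≤j | inj₁ i≤k = inj₂ (inj₂ (inj₁ (i≤k , k≤j)))
... | inj₁ i≤j | inj₂ k≤j | inj₂ k≤i = inj₂ (inj₁ (inj₂ (k≤i , i≤j)))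
... | inj₂ j≤i | inj₁ j≤k | inj₁ i≤k = inj₂ (inj₁ (inj₁ (j≤i , i≤k)))
... | inj₂ j≤i | inj₁ j≤k | inj₂ k≤i = inj₂ (inj₂ (inj₂ (j≤k , k≤i)))
... | inj₂ j≤i | inj₂ k≤j | _       = inj₁ (inj₂ (k≤j , j≤i))

Between-chain : ∀ {e a b c} → Between e a b → Between e b c → Between a b c
Between-chain (inj₁ (_ , a≤b)) (inj₁ (_ , b≤c)) = inj₁ (a≤b , b≤c)
Between-chain (inj₂ (b≤a , _)) (inj₂ (c≤b , _)) = inj₂ (c≤b , b≤a)
Between-chain (inj₁ (e≤a , _)) (inj₂ (c≤b , b≤e)) = inj₂ (c≤b , ≤-trans b≤e e≤a)
Between-chain (inj₂ (_ , a≤e)) (inj₁ (e≤b , b≤c)) = inj₁ (≤-trans a≤e e≤b , b≤c)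

Extreme : ℕ → ℕ → Set
Extreme k e = e ≡ 0 ⊎ suc e ≡ k

extreme-between-total : ∀ {k e a b} → Extreme k e → a < k → b < k → Between e a b ⊎ Between e b a
extreme-between-total {a = a} {b} (inj₁ refl) _ _ with ≤-total a b
... | inj₁ a≤b = inj₁ (inj₁ (z≤n , a≤b))
... | inj₂ b≤a = inj₂ (inj₁ (z≤n , b≤a))
extreme-between-total {a = a} {b} (inj₂ refl) (s≤s a≤e) (s≤s b≤e) with ≤-total a b
... | inj₁ a≤b = inj₂ (inj₂ (a≤b , b≤e))
... | inj₂ b≤a = inj₁ (inj₂ (b≤a , a≤e))

¬Between-below : ∀ {i j k} → j < i → j < k → ¬ Between i j k
¬Between-below j<i _ (inj₁ (i≤j , _)) = <⇒≱ j<i i≤j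
¬Between-below _ j<k (inj₂ (k≤j , _)) = <⇒≱ j<k k≤j

¬Between-above : ∀ {i j k} → i < j → k < j → ¬ Between i j k
¬Between-above _ k<j (inj₁ (_ , j≤k)) = <⇒≱ k<j j≤k
¬Between-above i<j _ (inj₂ (_ , j≤i)) = <⇒≱ i<j j≤i

Between-degenerate : ∀ {i j} → Between i j i → j ≡ i
Between-degenerate (inj₁ (i≤j , j≤i)) = ≤-antisym j≤i i≤j
Between-degenerate (inj₂ (i≤j , j≤i)) = ≤-antisym j≤i i≤j

∣-∣-additive : ∀ {i j k} → i ≤ j → j ≤ k → ∣ i - j ∣ + ∣ j - k ∣ ≡ ∣ i - k ∣
∣-∣-additive {i} i≤j j≤k with m≤n⇒∃[o]m+o≡n i≤j | m≤n⇒∃[o]m+o≡n j≤k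
... | x , refl | y , refl = begin
  ∣ i - i + x ∣ + ∣ i + x - i + x + y ∣ ≡⟨ cong₂ _+_ (∣m-m+n∣≡n i x) (∣m-m+n∣≡n (i + x) y) ⟩
  x + y                                 ≡⟨ sym (∣m-m+n∣≡n i (x + y)) ⟩
  ∣ i - i + (x + y) ∣                   ≡⟨ cong (λ t → ∣ i - t ∣) (sym (+-assoc i x y)) ⟩
  ∣ i - i + x + y ∣                     ∎
  where open ≡-Reasoning

Between⇒∣-∣-additive : ∀ {i j k} → Between i j k → ∣ i - j ∣ + ∣ j - k ∣ ≤ ∣ i - k ∣
Between⇒∣-∣-additive (inj₁ (i≤j , j≤k)) = ≤-reflexive (∣-∣-additive i≤j j≤k)
Between⇒∣-∣-additive {i} {j} {k} (inj₂ (k≤j , j≤i)) = ≤-reflexive (begin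
  ∣ i - j ∣ + ∣ j - k ∣ ≡⟨ cong₂ _+_ (∣-∣-comm i j) (∣-∣-comm j k) ⟩
  ∣ j - i ∣ + ∣ k - j ∣ ≡⟨ +-comm ∣ j - i ∣ ∣ k - j ∣ ⟩
  ∣ k - j ∣ + ∣ j - i ∣ ≡⟨ ∣-∣-additive k≤j j≤i ⟩
  ∣ k - i ∣             ≡⟨ ∣-∣-comm k i ⟩
  ∣ i - k ∣             ∎)
  where open ≡-Reasoning

∣-∣-additive⇒Between : ∀ i j k → ∣ i - j ∣ + ∣ j - k ∣ ≤ ∣ i - k ∣ → Between i j k
∣-∣-additive⇒Between zero j k h = inj₁ (z≤n , ≤-trans (m≤m+n j _) h)
∣-∣-additive⇒Between (suc i) zero zero h = inj₂ (z≤n , z≤n)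
∣-∣-additive⇒Between (suc i) (suc j) zero h = inj₂ (z≤n , ≤-trans (m≤n+m (suc j) _) h)
∣-∣-additive⇒Between (suc i) zero (suc k) h =
  contradiction h (<⇒≱ ∣i-k∣<)
  where
    ∣i-k∣< : ∣ i - k ∣ < suc i + suc k
    ∣i-k∣< = s≤s (≤-trans (∣m-n∣≤m⊔n i k) (≤-trans (m⊔n≤m+n i k) (+-monoʳ-≤ i (n≤1+n k))))
∣-∣-additive⇒Between (suc i) (suc j) (suc k) h with ∣-∣-additive⇒Between i j k h
... | inj₁ (i≤j , j≤k) = inj₁ (s≤s i≤j , s≤s j≤k)
... | inj₂ (k≤j , j≤i) = inj₂ (s≤s k≤j , s≤s j≤i)

-- Walks in a graph with a distance that edges increase by at most one

module PathMetric {G : Graph} (d : V G → V G → ℕ)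
  (d-refl : ∀ u → d u u ≡ 0)
  (d-sym : ∀ u v → d u v ≡ d v u)
  (d-triangle : ∀ u v w → d u w ≤ d u v + d v w)
  (d-edge : ∀ {u v} → E G u v → d u v ≤ 1)
  where

  MetricallyBetween : V G → V G → V G → Set
  MetricallyBetween a b c = d a b + d b c ≤ d a c

  MetricallyBetween-sym : ∀ {a b c} → MetricallyBetween a b c → MetricallyBetween c b a
  MetricallyBetween-sym {a} {b} {c} h =
    subst₂ _≤_ (trans (+-comm (d a b) (d b c)) (cong₂ _+_ (d-sym b c) (d-sym a b))) (d-sym a c) h

  index : ∀ {x u w} {p : Walk G u w} → x OnWalk p → ℕ
  index here-end = 0
  index (here e p) = 0
  index (there e p o) = suc (index o)

  d-≤-step : ∀ {u v x L} → E G u v → d v x ≤ L → d u x ≤ suc L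
  d-≤-step {u} {v} {x} e h = ≤-trans (d-triangle u v x) (+-mono-≤ (d-edge e) h)

  d-≤-length : ∀ {u w} (p : Walk G u w) → d u w ≤ length p
  d-≤-length [ u ] = ≤-reflexive (d-refl u)
  d-≤-length (u ∷⟨ e ⟩ p) = d-≤-step e (d-≤-length p)

  d-≤-index : ∀ {u w x} {p : Walk G u w} (o : x OnWalk p) → d u x ≤ index o
  d-≤-index {x = x} here-end = ≤-reflexive (d-refl x)
  d-≤-index {x = x} (here e p) = ≤-reflexive (d-refl x)
  d-≤-index (there e p o) = d-≤-step e (d-≤-index o)

  d-+-index-≤-index : ∀ {u w x y} {p : Walk G u w} (o₁ : x OnWalk p) (o₂ : y OnWalk p) →
                      index o₁ ≤ index o₂ → d x y + index o₁ ≤ index o₂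
  d-+-index-≤-index {x = x} here-end here-end _ = ≤-reflexive (trans (+-identityʳ _) (d-refl x))
  d-+-index-≤-index (here e p) o₂ _ = ≤-trans (≤-reflexive (+-identityʳ _)) (d-≤-index o₂)
  d-+-index-≤-index (there e p o₁) (there e p o₂) i≤j =
    ≤-trans (≤-reflexive (+-suc _ _)) (s≤s (d-+-index-≤-index o₁ o₂ (s≤s⁻¹ i≤j)))

  d-+-index-≤-length : ∀ {u w x} {p : Walk G u w} (o : x OnWalk p) → d x w + index o ≤ length p
  d-+-index-≤-length {x = x} here-end = ≤-reflexive (trans (+-identityʳ _) (d-refl x))
  d-+-index-≤-length (here e p) = ≤-trans (≤-reflexive (+-identityʳ _)) (d-≤-length (_ ∷⟨ e ⟩ p))
  d-+-index-≤-length (there e p o) = ≤-trans (≤-reflexive (+-suc _ _)) (s≤s (d-+-index-≤-length o))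

  Tight : ∀ {u w} → Walk G u w → Set
  Tight {u} {w} p = length p ≤ d u w

  -- Walking along p through a, b and c costs at least d u a + d a b + d b c + d c w, while
  -- tightness bounds the length of p by d u w ≤ d u a + d a c + d c w.
  ordered-on-tight⇒MetricallyBetween :
    ∀ {u w a b c} {p : Walk G u w} → Tight p → (oa : a OnWalk p) (ob : b OnWalk p) (oc : c OnWalk p) →
    index oa ≤ index ob → index ob ≤ index oc → MetricallyBetween a b c
  ordered-on-tight⇒MetricallyBetween {u} {w} {a} {b} {c} {p} tight oa ob oc i≤j j≤k =
    +-cancelˡ-≤ (d u a) _ _ (+-cancelʳ-≤ (d c w) _ _ (begin
      d u a + (d a b + d b c) + d c w ≤⟨ +-monoˡ-≤ (d c w) (+-monoˡ-≤ (d a b + d b c) (d-≤-index oa)) ⟩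
      i + (d a b + d b c) + d c w     ≡⟨ cong (_+ d c w) rearrange ⟩
      d b c + (d a b + i) + d c w     ≤⟨ +-monoˡ-≤ (d c w) (+-monoʳ-≤ (d b c) (d-+-index-≤-index oa ob i≤j)) ⟩
      d b c + index ob + d c w        ≤⟨ +-monoˡ-≤ (d c w) (d-+-index-≤-index ob oc j≤k) ⟩
      index oc + d c w                ≡⟨ +-comm (index oc) (d c w) ⟩
      d c w + index oc                ≤⟨ d-+-index-≤-length oc ⟩
      length p                        ≤⟨ tight ⟩
      d u w                           ≤⟨ ≤-trans (d-triangle u c w) (+-monoˡ-≤ (d c w) (d-triangle u a c)) ⟩
      d u a + d a c + d c w           ∎))
    where
      open ≤-Reasoning
      i : ℕ
      i = index oa
      rearrange : i + (d a b + d b c) ≡ d b c + (d a b + i)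
      rearrange = trans (+-comm i _) (trans (cong (_+ i) (+-comm (d a b) (d b c))) (+-assoc (d b c) (d a b) i))

  between-on-tight⇒MetricallyBetween :
    ∀ {u w a b c} {p : Walk G u w} → Tight p → (oa : a OnWalk p) (ob : b OnWalk p) (oc : c OnWalk p) →
    Between (index oa) (index ob) (index oc) → MetricallyBetween a b c
  between-on-tight⇒MetricallyBetween tight oa ob oc (inj₁ (i≤j , j≤k)) =
    ordered-on-tight⇒MetricallyBetween tight oa ob oc i≤j j≤k
  between-on-tight⇒MetricallyBetween tight oa ob oc (inj₂ (k≤j , j≤i)) =
    MetricallyBetween-sym (ordered-on-tight⇒MetricallyBetween tight oc ob oa k≤j j≤i)

  three-on-tight⇒MetricallyBetween :
    ∀ {u w x y z} {p : Walk G u w} → Tight p → x OnWalk p → y OnWalk p → z OnWalk p →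
    MetricallyBetween x y z ⊎ MetricallyBetween y x z ⊎ MetricallyBetween x z y
  three-on-tight⇒MetricallyBetween tight ox oy oz with Between-total (index ox) (index oy) (index oz)
  ... | inj₁ xyz = inj₁ (between-on-tight⇒MetricallyBetween tight ox oy oz xyz)
  ... | inj₂ (inj₁ yxz) = inj₂ (inj₁ (between-on-tight⇒MetricallyBetween tight oy ox oz yxz))
  ... | inj₂ (inj₂ xzy) = inj₂ (inj₂ (between-on-tight⇒MetricallyBetween tight ox oz oy xzy))

P-sym : ∀ {k} {i j : Fin k} → E (P k) i j → E (P k) j i
P-sym = swap

ascending-walk : ∀ {k} (δ : ℕ) (i j : Fin k) → toℕ i + δ ≡ toℕ j → Σ (Walk (P k) i j) λ p → length p ≡ δ
ascending-walk zero i j eq with toℕ-injective (trans (sym (+-identityʳ (toℕ i))) eq)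
... | refl = [ i ] , refl
ascending-walk {k} (suc δ) i j eq =
  let p , length-p = ascending-walk δ next j next+δ≡j
  in i ∷⟨ inj₁ (sym (toℕ-fromℕ< next<k)) ⟩ p , cong suc length-p
  where
    next<k : toℕ i + 1 < k
    next<k = ≤-<-trans (≤-trans (+-monoʳ-≤ (toℕ i) (s≤s z≤n)) (≤-reflexive eq)) (toℕ<n j)
    next : Fin k
    next = fromℕ< next<k
    next+δ≡j : toℕ next + δ ≡ toℕ j
    next+δ≡j = trans (cong (_+ δ) (toℕ-fromℕ< next<k)) (trans (+-assoc (toℕ i) 1 δ) eq)

path-walk : ∀ {k} (i j : Fin k) → Σ (Walk (P k) i j) λ p → length p ≡ ∣ toℕ i - toℕ j ∣
path-walk i j with ≤-total (toℕ i) (toℕ j)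
... | inj₁ i≤j =
  let p , length-p = ascending-walk (toℕ j ∸ toℕ i) i j (m+[n∸m]≡n i≤j)
  in p , trans length-p (sym (m≤n⇒∣m-n∣≡n∸m i≤j))
... | inj₂ j≤i =
  let p , length-p = ascending-walk (toℕ i ∸ toℕ j) j i (m+[n∸m]≡n j≤i)
  in reverseᵂ P-sym p , trans (length-reverseᵂ P-sym p) (trans length-p (sym (m≤n⇒∣n-m∣≡n∸m j≤i)))

P-edge⇒∣-∣≤1 : ∀ {k} {i j : Fin k} → E (P k) i j → ∣ toℕ i - toℕ j ∣ ≤ 1
P-edge⇒∣-∣≤1 {i = i} (inj₁ i+1≡j) rewrite sym i+1≡j = ≤-reflexive (∣m-m+n∣≡n (toℕ i) 1)
P-edge⇒∣-∣≤1 {j = j} (inj₂ j+1≡i) rewrite sym j+1≡i =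
  ≤-reflexive (trans (∣-∣-comm (toℕ j + 1) (toℕ j)) (∣m-m+n∣≡n (toℕ j) 1))

pair-has-no-three-distinct : ∀ {A : Set} {u v x y z : A} →
                             x ∈ u ∷ v ∷ [] → y ∈ u ∷ v ∷ [] → z ∈ u ∷ v ∷ [] → x ≢ y → y ≢ z → x ≢ z → ⊥
pair-has-no-three-distinct (here refl) (here refl) _ x≢y _ _ = x≢y refl
pair-has-no-three-distinct (there (here refl)) (there (here refl)) _ x≢y _ _ = x≢y refl
pair-has-no-three-distinct (here refl) (there (here refl)) (here refl) _ _ x≢z = x≢z refl
pair-has-no-three-distinct (here refl) (there (here refl)) (there (here refl)) _ y≢z _ = y≢z refl
pair-has-no-three-distinct (there (here refl)) (here refl) (here refl) _ y≢z _ = y≢z refl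
pair-has-no-three-distinct (there (here refl)) (here refl) (there (here refl)) _ _ x≢z = x≢z refl

module _ {G : Graph} where

  gp-pair : ∀ u v → GeneralPosition G (u ∷ v ∷ [])
  gp-pair u v _ _ _ _ a b c a∈ b∈ c∈ a≢b b≢c a≢c _ = pair-has-no-three-distinct a∈ b∈ c∈ a≢b b≢c a≢c

  gp-singleton : ∀ v → GeneralPosition G (v ∷ [])
  gp-singleton v u w p shortest a b c a∈ b∈ c∈ =
    gp-pair v v u w p shortest a b c (there a∈) (there b∈) (there c∈)

record ClosingReply (G : Graph) (a : V G) : Set where
  field
    reply       : V G
    reply≢a     : reply ≢ a
    third       : V G
    third-legal : Legal G (reply ∷ a ∷ []) third
    closes      : ∀ c → Legal G (reply ∷ a ∷ []) c → NoMove G (c ∷ reply ∷ a ∷ [])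

BWins-by-closing-replies : ∀ {G} → V G → ((a : V G) → ClosingReply G a) → BWins G
BWins-by-closing-replies v₀ replyTo = allLose (v₀ , (λ ()) , gp-singleton v₀) λ a _ →
  let open ClosingReply (replyTo a) in
  move reply ((λ { (here e) → reply≢a e ; (there ()) }) , gp-pair reply a)
       (allLose (third , third-legal) λ c c-legal → gameOver (closes c c-legal))

-- Grids

module Grid (n m : ℕ) where

  G : Graph
  G = P n □ P m

  Vertex : Set
  Vertex = V G

  X Y : Vertex → ℕ
  X u = toℕ (proj₁ u)
  Y u = toℕ (proj₂ u)

  D : Vertex → Vertex → ℕ
  D u v = ∣ X u - X v ∣ + ∣ Y u - Y v ∣

  D-refl : ∀ u → D u u ≡ 0
  D-refl u = cong₂ _+_ (∣n-n∣≡0 (X u)) (∣n-n∣≡0 (Y u))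

  D-sym : ∀ u v → D u v ≡ D v u
  D-sym u v = cong₂ _+_ (∣-∣-comm (X u) (X v)) (∣-∣-comm (Y u) (Y v))

  D-triangle : ∀ u v w → D u w ≤ D u v + D v w
  D-triangle u v w = ≤-trans (+-mono-≤ (∣-∣-triangle (X u) (X v) (X w)) (∣-∣-triangle (Y u) (Y v) (Y w)))
    (≤-reflexive (interchange ∣ X u - X v ∣ ∣ X v - X w ∣ ∣ Y u - Y v ∣ ∣ Y v - Y w ∣))

  D-edge : ∀ {u v} → E G u v → D u v ≤ 1
  D-edge {u} (inj₁ (refl , e)) rewrite ∣n-n∣≡0 (X u) = P-edge⇒∣-∣≤1 e
  D-edge {u} (inj₂ (refl , e)) rewrite ∣n-n∣≡0 (Y u) = ≤-trans (≤-reflexive (+-identityʳ _)) (P-edge⇒∣-∣≤1 e)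

  open PathMetric {G = G} D D-refl D-sym D-triangle D-edge

  geodesic : ∀ u w → Σ (Walk G u w) λ p → length p ≡ D u w
  geodesic (x₁ , y₁) (x₂ , y₂) with path-walk x₁ x₂ | path-walk y₁ y₂
  ... | px , length-px | py , length-py = horizontal ++ᵂ vertical , (begin
    length (horizontal ++ᵂ vertical)          ≡⟨ length-++ᵂ horizontal vertical ⟩
    length horizontal + length vertical       ≡⟨ cong₂ _+_ (length-mapᵂ _ _ px) (length-mapᵂ _ _ py) ⟩
    length px + length py                     ≡⟨ cong₂ _+_ length-px length-py ⟩
    ∣ toℕ x₁ - toℕ x₂ ∣ + ∣ toℕ y₁ - toℕ y₂ ∣ ∎)
    where
      open ≡-Reasoning
      horizontal : Walk G (x₁ , y₁) (x₂ , y₁)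
      horizontal = mapᵂ (_, y₁) (λ e → inj₂ (refl , e)) px
      vertical : Walk G (x₂ , y₁) (x₂ , y₂)
      vertical = mapᵂ (x₂ ,_) (λ e → inj₁ (refl , e)) py

  Shortest⇒Tight : ∀ {u w} {p : Walk G u w} → Shortest p → Tight p
  Shortest⇒Tight {u} {w} shortest = ≤-trans (shortest (proj₁ (geodesic u w))) (≤-reflexive (proj₂ (geodesic u w)))

  Tight⇒Shortest : ∀ {u w} {p : Walk G u w} → Tight p → Shortest p
  Tight⇒Shortest tight q = ≤-trans tight (d-≤-length q)

  Between² : Vertex → Vertex → Vertex → Set
  Between² a b c = Between (X a) (X b) (X c) × Between (Y a) (Y b) (Y c)

  Between²-sym : ∀ {a b c} → Between² a b c → Between² c b a
  Between²-sym (bx , by) = Between-sym bx , Between-sym by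

  MetricallyBetween⇒Between² : ∀ a b c → MetricallyBetween a b c → Between² a b c
  MetricallyBetween⇒Between² a b c h =
    ∣-∣-additive⇒Between _ _ _ (+-cancelʳ-≤ (∣ Y a - Y c ∣) _ _ (≤-trans (+-monoʳ-≤ (Xab + Xbc) Y-triangle) h′)) ,
    ∣-∣-additive⇒Between _ _ _ (+-cancelˡ-≤ (∣ X a - X c ∣) _ _ (≤-trans (+-monoˡ-≤ (Yab + Ybc) X-triangle) h′))
    where
      Xab Xbc Yab Ybc : ℕ
      Xab = ∣ X a - X b ∣
      Xbc = ∣ X b - X c ∣
      Yab = ∣ Y a - Y b ∣
      Ybc = ∣ Y b - Y c ∣
      X-triangle : ∣ X a - X c ∣ ≤ Xab + Xbc
      X-triangle = ∣-∣-triangle (X a) (X b) (X c)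
      Y-triangle : ∣ Y a - Y c ∣ ≤ Yab + Ybc
      Y-triangle = ∣-∣-triangle (Y a) (Y b) (Y c)
      h′ : (Xab + Xbc) + (Yab + Ybc) ≤ ∣ X a - X c ∣ + ∣ Y a - Y c ∣
      h′ = ≤-trans (≤-reflexive (interchange Xab Xbc Yab Ybc)) h

  Between²⇒MetricallyBetween : ∀ {a b c} → Between² a b c → MetricallyBetween a b c
  Between²⇒MetricallyBetween {a} {b} {c} (bx , by) =
    ≤-trans (≤-reflexive (interchange ∣ X a - X b ∣ ∣ Y a - Y b ∣ ∣ X b - X c ∣ ∣ Y b - Y c ∣))
            (+-mono-≤ (Between⇒∣-∣-additive bx) (Between⇒∣-∣-additive by))

  Collinear : Vertex → Vertex → Vertex → Set
  Collinear x y z = Between² x y z ⊎ Between² y x z ⊎ Between² x z y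

  Collinear-swapˡ : ∀ {x y z} → Collinear x y z → Collinear y x z
  Collinear-swapˡ (inj₁ xyz) = inj₂ (inj₁ xyz)
  Collinear-swapˡ (inj₂ (inj₁ yxz)) = inj₁ yxz
  Collinear-swapˡ (inj₂ (inj₂ xzy)) = inj₂ (inj₂ (Between²-sym xzy))

  Collinear-swapʳ : ∀ {x y z} → Collinear x y z → Collinear x z y
  Collinear-swapʳ (inj₁ xyz) = inj₂ (inj₂ xyz)
  Collinear-swapʳ (inj₂ (inj₁ yxz)) = inj₂ (inj₁ (Between²-sym yxz))
  Collinear-swapʳ (inj₂ (inj₂ xzy)) = inj₁ xzy

  Collinear-reverse : ∀ {x y z} → Collinear x y z → Collinear z y x
  Collinear-reverse = Collinear-swapˡ ∘ Collinear-swapʳ ∘ Collinear-swapˡ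

  OnShortestPath : Vertex → Vertex → Vertex → Set
  OnShortestPath x y z =
    Σ Vertex λ u → Σ Vertex λ w → Σ (Walk G u w) λ p → Shortest p × x OnWalk p × y OnWalk p × z OnWalk p

  OnShortestPath⇒Collinear : ∀ {x y z} → OnShortestPath x y z → Collinear x y z
  OnShortestPath⇒Collinear {x} {y} {z} (_ , _ , p , shortest , ox , oy , oz)
    with three-on-tight⇒MetricallyBetween (Shortest⇒Tight shortest) ox oy oz
  ... | inj₁ xyz = inj₁ (MetricallyBetween⇒Between² x y z xyz)
  ... | inj₂ (inj₁ yxz) = inj₂ (inj₁ (MetricallyBetween⇒Between² y x z yxz))
  ... | inj₂ (inj₂ xzy) = inj₂ (inj₂ (MetricallyBetween⇒Between² x z y xzy))

  Between²⇒shortest-path : ∀ {a b c} → Between² a b c →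
                           Σ (Walk G a c) λ p → Shortest p × a OnWalk p × b OnWalk p × c OnWalk p
  Between²⇒shortest-path {a} {b} {c} abc =
    p , Tight⇒Shortest tight , start-on p , on-++ᵂʳ ab (start-on bc) , end-on p
    where
      open ≤-Reasoning
      ab : Walk G a b
      ab = proj₁ (geodesic a b)
      bc : Walk G b c
      bc = proj₁ (geodesic b c)
      p : Walk G a c
      p = ab ++ᵂ bc
      tight : Tight p
      tight = begin
        length (ab ++ᵂ bc)     ≡⟨ length-++ᵂ ab bc ⟩
        length ab + length bc ≡⟨ cong₂ _+_ (proj₂ (geodesic a b)) (proj₂ (geodesic b c)) ⟩
        D a b + D b c         ≤⟨ Between²⇒MetricallyBetween abc ⟩
        D a c                 ∎

  Collinear⇒OnShortestPath : ∀ {x y z} → Collinear x y z → OnShortestPath x y z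
  Collinear⇒OnShortestPath (inj₁ xyz) =
    let p , shortest , ox , oy , oz = Between²⇒shortest-path xyz in _ , _ , p , shortest , ox , oy , oz
  Collinear⇒OnShortestPath (inj₂ (inj₁ yxz)) =
    let p , shortest , oy , ox , oz = Between²⇒shortest-path yxz in _ , _ , p , shortest , ox , oy , oz
  Collinear⇒OnShortestPath (inj₂ (inj₂ xzy)) =
    let p , shortest , ox , oz , oy = Between²⇒shortest-path xzy in _ , _ , p , shortest , ox , oy , oz

  CollinearFree : List Vertex → Set
  CollinearFree S = ∀ {x y z} → x ∈ S → y ∈ S → z ∈ S → x ≢ y → y ≢ z → x ≢ z → ¬ Collinear x y z

  CollinearFree⇒GeneralPosition : ∀ {S} → CollinearFree S → GeneralPosition G S
  CollinearFree⇒GeneralPosition free u w p shortest a b c a∈ b∈ c∈ a≢b b≢c a≢c (oa , ob , oc) =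
    free a∈ b∈ c∈ a≢b b≢c a≢c (OnShortestPath⇒Collinear (u , w , p , shortest , oa , ob , oc))

  GeneralPosition⇒CollinearFree : ∀ {S} → GeneralPosition G S → CollinearFree S
  GeneralPosition⇒CollinearFree gp {x} {y} {z} x∈ y∈ z∈ x≢y y≢z x≢z collinear =
    let u , w , p , shortest , on = Collinear⇒OnShortestPath collinear
    in gp u w p shortest x y z x∈ y∈ z∈ x≢y y≢z x≢z on

  CollinearFree-∷ : ∀ {c S} → CollinearFree S →
                    (∀ {x y} → x ∈ S → y ∈ S → x ≢ y → ¬ Collinear c x y) → CollinearFree (c ∷ S)
  CollinearFree-∷ free c-free (here refl) (here refl) _ x≢y _ _ _ = x≢y refl
  CollinearFree-∷ free c-free (here refl) (there _) (here refl) _ _ x≢z _ = x≢z refl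
  CollinearFree-∷ free c-free (here refl) (there y∈) (there z∈) _ y≢z _ = c-free y∈ z∈ y≢z
  CollinearFree-∷ free c-free (there _) (here refl) (here refl) _ y≢z _ _ = y≢z refl
  CollinearFree-∷ free c-free (there x∈) (here refl) (there z∈) _ _ x≢z = c-free x∈ z∈ x≢z ∘ Collinear-swapˡ
  CollinearFree-∷ free c-free (there x∈) (there y∈) (here refl) x≢y _ _ =
    c-free x∈ y∈ x≢y ∘ Collinear-swapˡ ∘ Collinear-swapʳ
  CollinearFree-∷ free c-free (there x∈) (there y∈) (there z∈) = free x∈ y∈ z∈

  Corner : Vertex → Set
  Corner v = Extreme n (X v) × Extreme m (Y v)

  Crossing : Vertex → Vertex → Vertex → Set
  Crossing k p q = Between (X k) (X p) (X q) × Between (Y k) (Y q) (Y p)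

  crossing-chain : ∀ {k p q r} → Crossing k p q → Crossing k q r → Between² p q r
  crossing-chain (kpq , kqp) (kqr , krq) = Between-chain kpq kqr , Between-sym (Between-chain krq kqp)

  corner-pair : ∀ {k} p q → Corner k → Collinear k p q ⊎ Crossing k p q ⊎ Crossing k q p
  corner-pair (px , py) (qx , qy) (kx , ky)
    with extreme-between-total kx (toℕ<n px) (toℕ<n qx) | extreme-between-total ky (toℕ<n py) (toℕ<n qy)
  ... | inj₁ xpq | inj₁ ypq = inj₁ (inj₁ (xpq , ypq))
  ... | inj₂ xqp | inj₂ yqp = inj₁ (inj₂ (inj₂ (xqp , yqp)))
  ... | inj₁ xpq | inj₂ yqp = inj₂ (inj₁ (xpq , yqp))
  ... | inj₂ xqp | inj₁ ypq = inj₂ (inj₂ (xqp , ypq))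

  corner-four : ∀ {k} p q r → Corner k →
                Collinear k p q ⊎ Collinear k q r ⊎ Collinear k p r ⊎ Collinear p q r
  corner-four p q r corner with corner-pair p q corner | corner-pair q r corner | corner-pair p r corner
  ... | inj₁ kpq | _ | _ = inj₁ kpq
  ... | _ | inj₁ kqr | _ = inj₂ (inj₁ kqr)
  ... | _ | _ | inj₁ kpr = inj₂ (inj₂ (inj₁ kpr))
  ... | inj₂ (inj₁ pq) | inj₂ (inj₁ qr) | _ = inj₂ (inj₂ (inj₂ (inj₁ (crossing-chain pq qr))))
  ... | inj₂ (inj₂ qp) | inj₂ (inj₂ rq) | _ = inj₂ (inj₂ (inj₂ (inj₁ (Between²-sym (crossing-chain rq qp)))))
  ... | inj₂ (inj₁ pq) | inj₂ (inj₂ rq) | inj₂ (inj₁ pr) =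
    inj₂ (inj₂ (inj₂ (inj₂ (inj₂ (crossing-chain pr rq)))))
  ... | inj₂ (inj₁ pq) | inj₂ (inj₂ rq) | inj₂ (inj₂ rp) =
    inj₂ (inj₂ (inj₂ (inj₂ (inj₁ (Between²-sym (crossing-chain rp pq))))))
  ... | inj₂ (inj₂ qp) | inj₂ (inj₁ qr) | inj₂ (inj₁ pr) =
    inj₂ (inj₂ (inj₂ (inj₂ (inj₁ (crossing-chain qp pr)))))
  ... | inj₂ (inj₂ qp) | inj₂ (inj₁ qr) | inj₂ (inj₂ rp) =
    inj₂ (inj₂ (inj₂ (inj₂ (inj₂ (Between²-sym (crossing-chain qr rp))))))

  corner-gp-has-no-four-distinct :
    ∀ {S k p q r} → GeneralPosition G S → Corner k → k ∈ S → p ∈ S → q ∈ S → r ∈ S →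
    p ≢ k → q ≢ k → r ≢ k → q ≢ p → r ≢ p → r ≢ q → ⊥
  corner-gp-has-no-four-distinct {p = p} {q} {r} gp corner k∈ p∈ q∈ r∈ p≢k q≢k r≢k q≢p r≢p r≢q =
    [ free q∈ p∈ k∈ q≢p p≢k q≢k ∘ Collinear-reverse ,
    [ free r∈ q∈ k∈ r≢q q≢k r≢k ∘ Collinear-reverse ,
    [ free r∈ p∈ k∈ r≢p p≢k r≢k ∘ Collinear-reverse ,
      free r∈ q∈ p∈ r≢q q≢p r≢p ∘ Collinear-reverse ]′ ]′ ]′
      (corner-four p q r corner)
    where
      free : CollinearFree _
      free = GeneralPosition⇒CollinearFree gp

  no-move-after-three-with-corner : ∀ {a b} → b ≢ a → Corner a ⊎ Corner b →
                                    ∀ c → Legal G (b ∷ a ∷ []) c → NoMove G (c ∷ b ∷ a ∷ [])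
  no-move-after-three-with-corner {a} {b} b≢a corner c (c∉ , _) d (d∉ , gp) =
    [ (λ a-corner → corner-gp-has-no-four-distinct gp a-corner a∈ b∈ c∈ d∈ b≢a c≢a d≢a c≢b d≢b d≢c) ,
      (λ b-corner → corner-gp-has-no-four-distinct gp b-corner b∈ a∈ c∈ d∈ (≢-sym b≢a) c≢b d≢b c≢a d≢a d≢c) ]′
      corner
    where
      d∈ : d ∈ d ∷ c ∷ b ∷ a ∷ []
      d∈ = here refl
      c∈ : c ∈ d ∷ c ∷ b ∷ a ∷ []
      c∈ = there (here refl)
      b∈ : b ∈ d ∷ c ∷ b ∷ a ∷ []
      b∈ = there (there (here refl))
      a∈ : a ∈ d ∷ c ∷ b ∷ a ∷ []
      a∈ = there (there (there (here refl)))
      c≢b : c ≢ b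
      c≢b = c∉ ∘ here
      c≢a : c ≢ a
      c≢a c≡a = c∉ (there (here c≡a))
      d≢c : d ≢ c
      d≢c = d∉ ∘ here
      d≢b : d ≢ b
      d≢b d≡b = d∉ (there (here d≡b))
      d≢a : d ≢ a
      d≢a d≡a = d∉ (there (there (here d≡a)))

-- The strategy for B

extremes-not-between-1 : ∀ {K u v} → 2 ≤ K → Extreme (suc K) u → Extreme (suc K) v → v ≢ u → ¬ Between u v 1
extremes-not-between-1 _ (inj₁ refl) (inj₁ refl) v≢u = contradiction refl v≢u
extremes-not-between-1 2≤K (inj₁ refl) (inj₂ refl) _ = ¬Between-above (≤-trans (s≤s z≤n) 2≤K) 2≤K
extremes-not-between-1 2≤K (inj₂ refl) (inj₁ refl) _ = ¬Between-below (≤-trans (s≤s z≤n) 2≤K) (s≤s z≤n)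
extremes-not-between-1 _ (inj₂ refl) (inj₂ refl) v≢u = contradiction refl v≢u

end-other-than : ∀ {K} → 0 < K → (e : ℕ) → Σ (Fin (suc K)) λ o → Extreme (suc K) (toℕ o) × toℕ o ≢ e
end-other-than {K} 0<K e with e ≟ 0
... | yes refl = fromℕ K , inj₂ (cong suc (toℕ-fromℕ K)) , <⇒≢ 0<K ∘ sym ∘ trans (sym (toℕ-fromℕ K))
... | no e≢0 = Fin.zero , inj₁ refl , ≢-sym e≢0

extreme-or-interior : ∀ {K x} → x < suc K → Extreme (suc K) x ⊎ (0 < x × x < K)
extreme-or-interior {x = zero} _ = inj₁ (inj₁ refl)
extreme-or-interior {K} {suc x} x<1+K with suc x ≟ K
... | yes refl = inj₁ (inj₂ refl)
... | no x≢K = inj₂ (s≤s z≤n , ≤∧≢⇒< (s≤s⁻¹ x<1+K) x≢K)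

-- The coordinates of the grid range over 0, …, N and 0, …, M.
module GridGame (N M : ℕ) (2≤N : 2 ≤ N) (0<M : 0 < M) where

  open Grid (suc N) (suc M)

  0<N : 0 < N
  0<N = ≤-trans (s≤s z≤n) 2≤N

  record CornerReply (a : Vertex) : Set where
    field
      b c       : Vertex
      b≢a       : b ≢ a
      c≢a       : c ≢ a
      c≢b       : c ≢ b
      ¬collinear : ¬ Collinear a b c
      corner    : Corner a ⊎ Corner b

  row-reply : ∀ a → 0 < X a → X a < N → CornerReply a
  row-reply a 0<x x<N with end-other-than 0<M (Y a)
  ... | y , y-extreme , y≢ = record
    { b = Fin.zero , y
    ; c = fromℕ N , y
    ; b≢a = <⇒≢ 0<x ∘ cong X
    ; c≢a = y≢ ∘ cong Y
    ; c≢b = <⇒≢ 0<N ∘ sym ∘ trans (sym (toℕ-fromℕ N)) ∘ cong X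
    ; ¬collinear =
        [ ¬Between-below 0<x 0<N ∘ subst (Between (X a) 0) (toℕ-fromℕ N) ∘ proj₁ ,
        [ y≢ ∘ sym ∘ Between-degenerate ∘ proj₂ ,
          ¬Between-above x<N 0<N ∘ subst (λ t → Between (X a) t 0) (toℕ-fromℕ N) ∘ proj₁ ]′ ]′
    ; corner = inj₂ (inj₁ refl , y-extreme)
    }

  column-reply : ∀ a → 0 < Y a → Y a < M → CornerReply a
  column-reply a 0<y y<M with end-other-than 0<N (X a)
  ... | x , x-extreme , x≢ = record
    { b = x , Fin.zero
    ; c = x , fromℕ M
    ; b≢a = <⇒≢ 0<y ∘ cong Y
    ; c≢a = x≢ ∘ cong X
    ; c≢b = <⇒≢ 0<M ∘ sym ∘ trans (sym (toℕ-fromℕ M)) ∘ cong Y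
    ; ¬collinear =
        [ ¬Between-below 0<y 0<M ∘ subst (Between (Y a) 0) (toℕ-fromℕ M) ∘ proj₂ ,
        [ x≢ ∘ sym ∘ Between-degenerate ∘ proj₁ ,
          ¬Between-above y<M 0<M ∘ subst (λ t → Between (Y a) t 0) (toℕ-fromℕ M) ∘ proj₂ ]′ ]′
    ; corner = inj₂ (x-extreme , inj₁ refl)
    }

  corner-reply : ∀ a → Corner a → CornerReply a
  corner-reply a (ax , ay) with end-other-than 0<N (X a) | end-other-than 0<M (Y a)
  ... | x , x-extreme , x≢ | y , _ , y≢ = record
    { b = x , proj₂ a
    ; c = fromℕ< 1<1+N , y
    ; b≢a = x≢ ∘ cong X
    ; c≢a = y≢ ∘ cong Y
    ; c≢b = y≢ ∘ cong Y
    ; ¬collinear =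
        [ extremes-not-between-1 2≤N ax x-extreme x≢ ∘ subst (Between (X a) (toℕ x)) one ∘ proj₁ ,
        [ extremes-not-between-1 2≤N x-extreme ax (≢-sym x≢) ∘ subst (Between (toℕ x) (X a)) one ∘ proj₁ ,
          y≢ ∘ Between-degenerate ∘ proj₂ ]′ ]′
    ; corner = inj₁ (ax , ay)
    }
    where
      1<1+N : 1 < suc N
      1<1+N = s≤s 0<N
      one : toℕ (fromℕ< 1<1+N) ≡ 1
      one = toℕ-fromℕ< 1<1+N

  reply : ∀ a → CornerReply a
  reply a with extreme-or-interior (toℕ<n (proj₁ a)) | extreme-or-interior (toℕ<n (proj₂ a))
  ... | inj₂ (0<x , x<N) | _ = row-reply a 0<x x<N
  ... | inj₁ _ | inj₂ (0<y , y<M) = column-reply a 0<y y<M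
  ... | inj₁ ax | inj₁ ay = corner-reply a (ax , ay)

  closing-reply : ∀ a → CornerReply a → ClosingReply G a
  closing-reply a r = record
    { reply = b
    ; reply≢a = b≢a
    ; third = c
    ; third-legal = c∉ , CollinearFree⇒GeneralPosition (CollinearFree-∷ ba-free c-not-collinear)
    ; closes = no-move-after-three-with-corner b≢a corner
    }
    where
      open CornerReply r
      ba-free : CollinearFree (b ∷ a ∷ [])
      ba-free = GeneralPosition⇒CollinearFree (gp-pair b a)
      c∉ : c ∉ b ∷ a ∷ []
      c∉ (here c≡b) = c≢b c≡b
      c∉ (there (here c≡a)) = c≢a c≡a
      c-not-collinear : ∀ {x y} → x ∈ b ∷ a ∷ [] → y ∈ b ∷ a ∷ [] → x ≢ y → ¬ Collinear c x y
      c-not-collinear (here refl) (here refl) x≢y = contradiction refl x≢y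
      c-not-collinear (here refl) (there (here refl)) _ = ¬collinear ∘ Collinear-reverse
      c-not-collinear (there (here refl)) (here refl) _ = ¬collinear ∘ Collinear-swapʳ ∘ Collinear-swapˡ
      c-not-collinear (there (here refl)) (there (here refl)) x≢y = contradiction refl x≢y

theorem4p5 : (n m : ℕ) → 3 ≤ n → 2 ≤ m → BWins (P n □ P m)
theorem4p5 (suc N) (suc M) (s≤s 2≤N) (s≤s 0<M) =
  BWins-by-closing-replies (Fin.zero , Fin.zero) (λ a → closing-reply a (reply a))
  where open GridGame N M 2≤N 0<M
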